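{- Let $\varphi$ be a fully packed loop of size $n$ and let $\gamma$ be an alternating loop in $\varphi$. Then the flip of $\gamma$ applied to $\varphi$ can be obtained from $\varphi$ by some finite sequence of plaquette flips.
   Context: The grid graph of size $n$ has $n^2$ internal vertices $(i,j)$, $1\le i,j\le n$, with rows increasing downward and columns to the right. Internal edges join horizontally or vertically adjacent internal vertices. There are also $4n$ external edges, each joining a boundary internal vertex to a degree-one external vertex: one above each vertex of row $1$, one below each vertex of row $n$, one left of each vertex of column $1$, and one right of each vertex of column $n$. A fully packed loop (FPL) of size $n$ is a colouring of all these edges dark or light such that: - every internal vertex is incident to exactly two dark and two light edges (six-vertex condition); - going once around the boundary, the $4n$ external edges alternate in colour, with the external edge above vertex $(1,1)$ dark (domain wall boundary conditions). An alternating loop in an FPL is a simple closed lattice loop made of internal edges whose colours alternate along the loop. The flip of a closed lattice loop swaps dark and light on all of its edges if the loop is alternating, and does nothing otherwise; the result is again an FPL. A plaquette flip is the flip of the boundary of a single unit box of the grid. -}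

module Defs where

open import Data.Nat using (ℕ; zero; suc; _+_; _*_; _≤_; _<_; _⊓_; _≡ᵇ_)
import Data.Nat as ℕ
open import Data.Bool using (Bool; true; false; not; if_then_else_)
import Data.Bool as 𝔹
open import Data.Product using (_×_; _,_; proj₁; proj₂)
open import Data.Sum using (_⊎_)
open import Data.List using (List; []; _∷_; _++_; map; zip; length; upTo; reverse)
open import Data.Nat.ListAction using (sum)
open import Data.List.Relation.Unary.All using (All; all?)
open import Data.List.Relation.Unary.Unique.Propositional using (Unique)
open import Relation.Nullary using (Dec; yes; no; ¬_; ¬?)
open import Relation.Nullary.Decidable using (⌊_⌋; map′)
open import Relation.Binary.PropositionalEquality using (_≡_; _≢_; refl; cong; cong₂)
open import Relation.Binary using (DecidableEquality)

-- Vertices are pairs (row , column) of naturals.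
-- The internal vertices of the size-n grid are (r , c) with 1 ≤ r,c ≤ n
-- (rows increase downward, columns to the right).  The external vertices
-- sit at row 0 / row n+1 / column 0 / column n+1.

Vertex : Set
Vertex = ℕ × ℕ

Internal : ℕ → Vertex → Set
Internal n (r , c) = (1 ≤ r × r ≤ n) × (1 ≤ c × c ≤ n)

-- Edges of the square lattice:
--   hor r c  joins (r , c) and (r , c+1)
--   ver r c  joins (r , c) and (r+1 , c)
data Edge : Set where
  hor : ℕ → ℕ → Edge
  ver : ℕ → ℕ → Edge

hor-inj : ∀ {a b c d} → hor a b ≡ hor c d → (a ≡ c) × (b ≡ d)
hor-inj refl = refl , refl

ver-inj : ∀ {a b c d} → ver a b ≡ ver c d → (a ≡ c) × (b ≡ d)
ver-inj refl = refl , refl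

_≟E_ : DecidableEquality Edge
hor a b ≟E hor c d with a ℕ.≟ c | b ℕ.≟ d
... | yes refl | yes refl = yes refl
... | no p | _ = no (λ q → p (proj₁ (hor-inj q)))
... | yes _ | no p = no (λ q → p (proj₂ (hor-inj q)))
hor _ _ ≟E ver _ _ = no (λ ())
ver _ _ ≟E hor _ _ = no (λ ())
ver a b ≟E ver c d with a ℕ.≟ c | b ℕ.≟ d
... | yes refl | yes refl = yes refl
... | no p | _ = no (λ q → p (proj₁ (ver-inj q)))
... | yes _ | no p = no (λ q → p (proj₂ (ver-inj q)))

_∈E?_ : (e : Edge) → (es : List Edge) → Bool
e ∈E? [] = false
e ∈E? (f ∷ es) = if ⌊ e ≟E f ⌋ then true else (e ∈E? es)

-- Colourings: true = dark, false = light.  Only the edges of the grid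
-- graph of size n (internal and external) are relevant; flips never
-- change any other edge.

Colouring : Set
Colouring = Edge → Bool

countDark : List Bool → ℕ
countDark bs = sum (map (λ b → if b then 1 else 0) bs)

-- Six-vertex condition at every internal vertex (suc i , suc j), i,j < n:
-- its left, right, upper and lower edges; exactly two are dark.
SixVertex : ℕ → Colouring → Set
SixVertex n φ = ∀ i j → i < n → j < n →
  countDark (φ (hor (suc i) j) ∷ φ (hor (suc i) (suc j)) ∷
             φ (ver i (suc j)) ∷ φ (ver (suc i) (suc j)) ∷ []) ≡ 2

-- The 4n external edges in clockwise order around the boundary,
-- starting with the edge above vertex (1,1):
-- top (left to right), right (top to bottom), bottom (right to left),
-- left (bottom to top).
boundaryEdges : ℕ → List Edge
boundaryEdges n =
     map (λ k → ver 0 (suc k)) (upTo n)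
  ++ map (λ k → hor (suc k) n) (upTo n)
  ++ reverse (map (λ k → ver n (suc k)) (upTo n))
  ++ reverse (map (λ k → hor (suc k) 0) (upTo n))

altFrom : ℕ → Bool → List Bool
altFrom zero b = []
altFrom (suc k) b = b ∷ altFrom k (not b)

-- Domain wall boundary conditions: going once around the boundary the
-- external edges alternate in colour, the one above (1,1) being dark.
-- (Since 4n is even, the alternation is also consistent cyclically.)
DomainWall : ℕ → Colouring → Set
DomainWall n φ = map φ (boundaryEdges n) ≡ altFrom (4 * n) true

FPL : ℕ → Colouring → Set
FPL n φ = SixVertex n φ × DomainWall n φ

cyclicPairs : {A : Set} → List A → List (A × A)
cyclicPairs [] = []
cyclicPairs (x ∷ xs) = zip (x ∷ xs) (xs ++ x ∷ [])

Adjacent : Vertex → Vertex → Set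
Adjacent (r , c) (r' , c') =
    (r ≡ r' × (suc c ≡ c' ⊎ suc c' ≡ c))
  ⊎ (c ≡ c' × (suc r ≡ r' ⊎ suc r' ≡ r))

edgeBetween : Vertex → Vertex → Edge
edgeBetween (r , c) (r' , c') =
  if r ≡ᵇ r' then hor r (c ⊓ c') else ver (r ⊓ r') c

loopEdges : List Vertex → List Edge
loopEdges vs = map (λ p → edgeBetween (proj₁ p) (proj₂ p)) (cyclicPairs vs)

record SimpleLoop (n : ℕ) : Set where
  field
    verts    : List Vertex
    long     : 3 ≤ length verts
    distinct : Unique verts
    internal : All (Internal n) verts
    adjacent : All (λ p → Adjacent (proj₁ p) (proj₂ p)) (cyclicPairs verts)
open SimpleLoop public

AlternatingSeq : List Bool → Set
AlternatingSeq bs = All (λ p → proj₁ p ≢ proj₂ p) (cyclicPairs bs)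

alternatingSeq? : (bs : List Bool) → Dec (AlternatingSeq bs)
alternatingSeq? bs = all? (λ p → ¬? (proj₁ p 𝔹.≟ proj₂ p)) (cyclicPairs bs)

AlternatingAlong : Colouring → List Vertex → Set
AlternatingAlong φ vs = AlternatingSeq (map φ (loopEdges vs))

AlternatingLoop : {n : ℕ} → Colouring → SimpleLoop n → Set
AlternatingLoop φ γ = AlternatingAlong φ (verts γ)

flipAlong : Colouring → List Vertex → Colouring
flipAlong φ vs with alternatingSeq? (map φ (loopEdges vs))
... | yes _ = λ e → if e ∈E? loopEdges vs then not (φ e) else φ e
... | no _  = φ

flipLoop : {n : ℕ} → Colouring → SimpleLoop n → Colouring
flipLoop φ γ = flipAlong φ (verts γ)

-- Plaquettes: unit boxes of the grid, with top-left corner (r , c),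
-- 1 ≤ r,c and r,c < n (so all four corners are internal vertices).

record Box (n : ℕ) : Set where
  constructor box
  field
    row col : ℕ
    row≥1 : 1 ≤ row
    row<n : row < n
    col≥1 : 1 ≤ col
    col<n : col < n

boxVerts : {n : ℕ} → Box n → List Vertex
boxVerts (box r c _ _ _ _) =
  (r , c) ∷ (r , suc c) ∷ (suc r , suc c) ∷ (suc r , c) ∷ []

plaquetteFlip : {n : ℕ} → Colouring → Box n → Colouring
plaquetteFlip φ b = flipAlong φ (boxVerts b)

data PlaquetteReachable (n : ℕ) : Colouring → Colouring → Set where
  done : ∀ {φ ψ} → (∀ e → φ e ≡ ψ e) → PlaquetteReachable n φ ψ
  step : ∀ {φ ψ} (b : Box n) →
         PlaquetteReachable n (plaquetteFlip φ b) ψ →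
         PlaquetteReachable n φ ψ

-- Part one (flip-fpl): the flip ψ is again an FPL, since
-- at each vertex of γ its two loop edges have different colours and are
-- exchanged, and γ only uses internal edges, so ψ agrees with φ off them.
-- Part two (connect): any two FPLs χ, ω agreeing off the internal edges are
-- connected by plaquette flips.  Edge spins, comparing colours with a fixed
-- checkerboard, integrate to heights on the faces; the six-vertex condition
-- makes them path independent (height-down), domain walls fix them on the
-- boundary (BoundaryHeights), and they determine the FPL (heights-determine).
-- If χ lies above ω somewhere, a face of maximal priority among those is an
-- interior local maximum of the height (topFace-local-maximum), whose box is
-- alternating; flipping it lowers the total height difference by one.
module Submission where

open import Data.Nat using (ℕ; zero; suc; _+_; _∸_; _≤_; _<_; _≤?_; _<?_; _≟_; _≡ᵇ_; z≤n; s≤s; ≤-pred; ∣_-_∣)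
open import Data.Nat.Properties
  using (+-assoc; +-cancelʳ-≡; +-cancelˡ-≡; +-comm; +-identityʳ; +-monoʳ-≤; +-suc; +-∸-assoc; 1+n≢0; 1+n≢n;
         <-cmp; <-irrefl; <⇒≢; <⇒≤; m<n⇒m<1+n; m≤m+n; m≤n⇒m≤1+n; m≤n⇒m⊓n≡m; m≤n⇒∣n-m∣≡n∸m; m≥n⇒m⊓n≡n;
         n≤1+n; suc-injective; ∣-∣-comm; ≤-antisym; ≤-refl; ≤-reflexive; ≤-totalOrder; ≤-trans; ≤∧≢⇒<; ≮⇒≥)
open import Data.Nat.Solver using (module +-*-Solver)
open import Data.Bool using (Bool; true; false; not; if_then_else_)
open import Data.Bool.Properties using (not-involutive; not-injective; ¬-not)
open import Data.Product using (Σ; _×_; _,_; proj₁; proj₂)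
import Data.Product as Product
open import Data.Product.Properties using (≡-dec)
open import Data.Sum using (_⊎_; inj₁; inj₂; [_,_]′)
import Data.Sum
open import Data.Empty using (⊥-elim)
open import Function using (_∘_)
open import Data.List using (List; []; _∷_; _++_; map; zip; length; upTo; reverse; cartesianProduct; filter)
open import Data.List.Properties using (map-++; ++-assoc; ++-identityʳ; map-cong; map-cong-local; map-∘; zip-map; ∷-injective)
open import Data.List.Relation.Unary.All as All using (All; []; _∷_)
import Data.List.Relation.Unary.All.Properties as All
open import Data.List.Relation.Unary.Any using (Any; here; there; any?)
open import Data.List.Relation.Unary.AllPairs as AllPairs using ([]; _∷_)
open import Data.List.Relation.Unary.Unique.Propositional using (Unique)
open import Data.List.Membership.Propositional using (_∈_; _∉_; find; lose)
open import Data.List.Membership.Propositional.Properties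
  using (∈-map⁺; ∈-map⁻; ∈-++⁻; ∈-∃++; ∈-upTo⁺; ∈-upTo⁻; ∈-cartesianProduct⁺; ∈-cartesianProduct⁻; ∈-filter⁺; ∈-filter⁻)
open import Data.List.Membership.DecPropositional (≡-dec _≟_ _≟_) using (_∈?_)
open import Data.List.Relation.Binary.Permutation.Propositional using (_↭_; ↭-sym; ↭⇒↭ₛ)
open import Data.List.Relation.Binary.Permutation.Propositional.Properties
  using (++-comm; All-resp-↭; ∈-resp-↭; ↭-length; ↭-reverse)
open import Data.List.Relation.Binary.Permutation.Setoid.Properties using (Unique-resp-↭)
open import Relation.Nullary using (Dec; yes; no; ¬_)
open import Relation.Binary using (tri<; tri≈; tri>)
open import Relation.Binary.PropositionalEquality
open import Defs

bit : Bool → ℕ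
bit b = if b then 1 else 0

∈E?-complete : ∀ {e es} → e ∈ es → (e ∈E? es) ≡ true
∈E?-complete {e} {f ∷ es} e∈ with e ≟E f | e∈
... | yes _ | _ = refl
... | no e≢f | here e≡f = ⊥-elim (e≢f e≡f)
... | no _ | there e∈es = ∈E?-complete e∈es

∈E?-sound : ∀ {e es} → (e ∈E? es) ≡ true → e ∈ es
∈E?-sound {e} {f ∷ es} test with e ≟E f
... | yes refl = here refl
... | no _ = there (∈E?-sound test)

∈E?-∉ : ∀ {e es} → e ∉ es → (e ∈E? es) ≡ false
∈E?-∉ {e} {es} e∉ with e ∈E? es in test
... | true = ⊥-elim (e∉ (∈E?-sound test))
... | false = refl

∈E?-false : ∀ {e es} → (e ∈E? es) ≡ false → e ∉ es
∈E?-false test e∈ with trans (sym test) (∈E?-complete e∈)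
... | ()

toggle : Colouring → List Edge → Colouring
toggle φ L e = if e ∈E? L then not (φ e) else φ e

toggle-∈ : ∀ φ {L e} → e ∈ L → toggle φ L e ≡ not (φ e)
toggle-∈ φ {e = e} e∈ = cong (λ t → if t then not (φ e) else φ e) (∈E?-complete e∈)

toggle-∉ : ∀ φ {L e} → e ∉ L → toggle φ L e ≡ φ e
toggle-∉ φ {e = e} e∉ = cong (λ t → if t then not (φ e) else φ e) (∈E?-∉ e∉)

module _ {A : Set} where

  consecutive : List A → List (A × A)
  consecutive [] = []
  consecutive (_ ∷ []) = []
  consecutive (x ∷ y ∷ zs) = (x , y) ∷ consecutive (y ∷ zs)

  zip-consecutive : ∀ y ys (z : A) → zip (y ∷ ys) (ys ++ z ∷ []) ≡ consecutive (y ∷ ys ++ z ∷ [])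
  zip-consecutive y [] z = refl
  zip-consecutive y (y' ∷ ys) z = cong ((y , y') ∷_) (zip-consecutive y' ys z)

  cyclicPairs-closed : ∀ x xs → cyclicPairs (x ∷ xs) ≡ consecutive (x ∷ xs ++ x ∷ [])
  cyclicPairs-closed x xs = zip-consecutive x xs x

  consecutive-++ : ∀ P (y : A) Q → consecutive (P ++ y ∷ Q) ≡ consecutive (P ++ y ∷ []) ++ consecutive (y ∷ Q)
  consecutive-++ [] y Q = refl
  consecutive-++ (p ∷ []) y Q = refl
  consecutive-++ (p ∷ p' ∷ P) y Q = cong ((p , p') ∷_) (consecutive-++ (p' ∷ P) y Q)

  cyclicPairs-∈ : ∀ {vs : List A} {p q} → (p , q) ∈ cyclicPairs vs → p ∈ vs × q ∈ vs
  cyclicPairs-∈ {x ∷ xs} pq∈ = let p∈ , q∈ = zip-∈ {x ∷ xs} {xs ++ x ∷ []} pq∈ in p∈ , closing q∈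
    where
    closing : ∀ {q} → q ∈ xs ++ x ∷ [] → q ∈ x ∷ xs
    closing q∈ with ∈-++⁻ xs q∈
    ... | inj₁ q∈xs = there q∈xs
    ... | inj₂ (here refl) = here refl
    zip-∈ : ∀ {ys zs : List A} {p q : A} → (p , q) ∈ zip ys zs → p ∈ ys × q ∈ zs
    zip-∈ {_ ∷ _} {_ ∷ _} (here refl) = here refl , here refl
    zip-∈ {_ ∷ ys} {_ ∷ zs} (there pq∈) = let p∈ , q∈ = zip-∈ {ys} {zs} pq∈ in there p∈ , there q∈

  cyclicPairs-split : ∀ (x : A) X y Y →
    cyclicPairs (x ∷ X ++ y ∷ Y) ≡ consecutive (x ∷ X ++ y ∷ []) ++ consecutive (y ∷ Y ++ x ∷ [])
  cyclicPairs-split x X y Y = begin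
    cyclicPairs (x ∷ X ++ y ∷ Y)                      ≡⟨ cyclicPairs-closed x (X ++ y ∷ Y) ⟩
    consecutive (x ∷ (X ++ y ∷ Y) ++ x ∷ [])          ≡⟨ cong (λ l → consecutive (x ∷ l)) (++-assoc X (y ∷ Y) (x ∷ [])) ⟩
    consecutive ((x ∷ X) ++ y ∷ Y ++ x ∷ [])          ≡⟨ consecutive-++ (x ∷ X) y (Y ++ x ∷ []) ⟩
    consecutive (x ∷ X ++ y ∷ []) ++ consecutive (y ∷ Y ++ x ∷ []) ∎
    where open ≡-Reasoning

Rotation : {A : Set} → List A → List A → Set
Rotation {A} L L' = Σ (List A) λ X → Σ (List A) λ Y → L ≡ X ++ Y × L' ≡ Y ++ X

rotation-to-front : ∀ {A : Set} {v : A} {L} → v ∈ L → Σ (List A) λ T → Rotation L (v ∷ T)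
rotation-to-front v∈ with ∈-∃++ v∈
... | X , Y , refl = Y ++ X , X , _ ∷ Y , refl , refl

rotation-↭ : ∀ {A : Set} {L L' : List A} → Rotation L L' → L ↭ L'
rotation-↭ (X , Y , refl , refl) = ++-comm X Y

rotation-cyclicPairs : ∀ {A : Set} {L L' : List A} → Rotation L L' → Rotation (cyclicPairs L) (cyclicPairs L')
rotation-cyclicPairs ([] , Y , refl , refl) =
  [] , cyclicPairs Y , refl , trans (cong cyclicPairs (++-identityʳ Y)) (sym (++-identityʳ _))
rotation-cyclicPairs (x ∷ X , [] , refl , refl) =
  cyclicPairs (x ∷ X) , [] , trans (cong cyclicPairs (++-identityʳ (x ∷ X))) (sym (++-identityʳ _)) , refl
rotation-cyclicPairs (x ∷ X , y ∷ Y , refl , refl) =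
  consecutive (x ∷ X ++ y ∷ []) , consecutive (y ∷ Y ++ x ∷ []) ,
  cyclicPairs-split x X y Y , cyclicPairs-split y Y x X

rotation-map : ∀ {A B : Set} (f : A → B) {L L'} → Rotation L L' → Rotation (map f L) (map f L')
rotation-map f (X , Y , refl , refl) = map f X , map f Y , map-++ f X Y , map-++ f Y X

lastOf : {A : Set} → A → List A → A
lastOf a [] = a
lastOf a (x ∷ xs) = lastOf x xs

lastOf-∈ : ∀ {A : Set} (a : A) xs → lastOf a xs ∈ a ∷ xs
lastOf-∈ a [] = here refl
lastOf-∈ a (x ∷ xs) = there (lastOf-∈ x xs)

lastOf-map : ∀ {A B : Set} (f : A → B) a xs → lastOf (f a) (map f xs) ≡ f (lastOf a xs)
lastOf-map f a [] = refl
lastOf-map f a (x ∷ xs) = lastOf-map f x xs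

module _ {A : Set} where

  lastStep-∈ : ∀ y ys (z : A) → (lastOf y ys , z) ∈ consecutive (y ∷ ys ++ z ∷ [])
  lastStep-∈ y [] z = here refl
  lastStep-∈ y (y' ∷ ys) z = there (lastStep-∈ y' ys z)

  lastOf-consecutive : ∀ (a : A × A) y ys z → lastOf a (consecutive (y ∷ ys ++ z ∷ [])) ≡ (lastOf y ys , z)
  lastOf-consecutive a y [] z = refl
  lastOf-consecutive a y (y' ∷ ys) z = lastOf-consecutive (y , y') y' ys z

  step-source-∈ : ∀ y ys (z : A) {p q} → (p , q) ∈ consecutive (y ∷ ys ++ z ∷ []) → p ∈ y ∷ ys
  step-source-∈ y [] z (here refl) = here refl
  step-source-∈ y (y' ∷ ys) z (here refl) = here refl
  step-source-∈ y (y' ∷ ys) z (there pq∈) = there (step-source-∈ y' ys z pq∈)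

  step-into-end : ∀ y ys (z : A) {p} → (p , z) ∈ consecutive (y ∷ ys ++ z ∷ []) → z ∉ ys → p ≡ lastOf y ys
  step-into-end y [] z (here refl) z∉ = refl
  step-into-end y (y' ∷ ys) z (here refl) z∉ = ⊥-elim (z∉ (here refl))
  step-into-end y (y' ∷ ys) z (there pz∈) z∉ = step-into-end y' ys z pz∈ (λ z∈ → z∉ (there z∈))

  closingPair-∈ : ∀ (x : A) xs → (lastOf x xs , x) ∈ cyclicPairs (x ∷ xs)
  closingPair-∈ x xs = subst ((lastOf x xs , x) ∈_) (sym (cyclicPairs-closed x xs)) (lastStep-∈ x xs x)

alternating-ends : ∀ b bs → AlternatingSeq (b ∷ bs) → lastOf b bs ≢ b
alternating-ends b bs alt = All.lookup alt (closingPair-∈ b bs)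

cyclicPairs-map : ∀ {A B : Set} (f : A → B) xs → cyclicPairs (map f xs) ≡ map (Product.map f f) (cyclicPairs xs)
cyclicPairs-map f [] = refl
cyclicPairs-map f (x ∷ xs) =
  trans (cong (zip (f x ∷ map f xs)) (sym (map-++ f xs (x ∷ [])))) (zip-map f f (x ∷ xs) (xs ++ x ∷ []))

alternating-not : ∀ bs → AlternatingSeq bs → AlternatingSeq (map not bs)
alternating-not bs alt rewrite cyclicPairs-map not bs =
  All.map⁺ (All.map (λ b≢b' nb≡nb' → b≢b' (not-injective nb≡nb')) alt)

flip-alternating : ∀ φ vs → AlternatingAlong φ vs → flipAlong φ vs ≗ toggle φ (loopEdges vs)
flip-alternating φ vs alt e with alternatingSeq? (map φ (loopEdges vs))
... | yes _ = refl
... | no ¬alt = ⊥-elim (¬alt alt)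

flip-off-loop : ∀ φ vs {e} → e ∉ loopEdges vs → flipAlong φ vs e ≡ φ e
flip-off-loop φ vs e∉ with alternatingSeq? (map φ (loopEdges vs))
... | yes _ = toggle-∉ φ e∉
... | no _ = refl

flip-involutive : ∀ φ vs → AlternatingAlong φ vs → flipAlong (flipAlong φ vs) vs ≗ φ
flip-involutive φ vs alt e = begin
  flipAlong φ' vs e      ≡⟨ flip-alternating φ' vs alt' e ⟩
  toggle φ' L e          ≡⟨ toggle-twice ⟩
  φ e                    ∎
  where
  open ≡-Reasoning
  L = loopEdges vs
  φ' = flipAlong φ vs
  flipped : ∀ {x} → x ∈ L → φ' x ≡ not (φ x)
  flipped x∈ = trans (flip-alternating φ vs alt _) (toggle-∈ φ x∈)
  alt' : AlternatingAlong φ' vs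
  alt' = subst AlternatingSeq
           (sym (trans (map-cong-local (All.tabulate flipped)) (map-∘ L)))
           (alternating-not (map φ L) alt)
  toggle-twice : toggle φ' L e ≡ φ e
  toggle-twice with e ∈E? L in test
  ... | true = trans (cong not (flipped (∈E?-sound test))) (not-involutive (φ e))
  ... | false = flip-off-loop φ vs (∈E?-false test)

flip-cong : ∀ {φ ψ} vs → φ ≗ ψ → flipAlong φ vs ≗ flipAlong ψ vs
flip-cong {φ} {ψ} vs φ≗ψ e with alternatingSeq? (map φ (loopEdges vs)) | alternatingSeq? (map ψ (loopEdges vs))
... | yes _ | yes _ = cong (λ b → if e ∈E? loopEdges vs then not b else b) (φ≗ψ e)
... | yes alt | no ¬alt = ⊥-elim (¬alt (subst AlternatingSeq (map-cong φ≗ψ (loopEdges vs)) alt))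
... | no ¬alt | yes alt = ⊥-elim (¬alt (subst AlternatingSeq (sym (map-cong φ≗ψ (loopEdges vs))) alt))
... | no _ | no _ = φ≗ψ e

ends : Edge → Vertex × Vertex
ends (hor r c) = (r , c) , (r , suc c)
ends (ver r c) = (r , c) , (suc r , c)

Incident : Vertex → Edge → Set
Incident v e = v ≡ proj₁ (ends e) ⊎ v ≡ proj₂ (ends e)

≡ᵇ-refl : ∀ m → (m ≡ᵇ m) ≡ true
≡ᵇ-refl zero = refl
≡ᵇ-refl (suc m) = ≡ᵇ-refl m

≡ᵇ-suc : ∀ m → (m ≡ᵇ suc m) ≡ false
≡ᵇ-suc zero = refl
≡ᵇ-suc (suc m) = ≡ᵇ-suc m

suc-≡ᵇ : ∀ m → (suc m ≡ᵇ m) ≡ false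
suc-≡ᵇ zero = refl
suc-≡ᵇ (suc m) = suc-≡ᵇ m

edgeBetween-right : ∀ r c → edgeBetween (r , c) (r , suc c) ≡ hor r c
edgeBetween-right r c rewrite ≡ᵇ-refl r | m≤n⇒m⊓n≡m (n≤1+n c) = refl

edgeBetween-left : ∀ r c → edgeBetween (r , suc c) (r , c) ≡ hor r c
edgeBetween-left r c rewrite ≡ᵇ-refl r | m≥n⇒m⊓n≡n (n≤1+n c) = refl

edgeBetween-down : ∀ r c → edgeBetween (r , c) (suc r , c) ≡ ver r c
edgeBetween-down r c rewrite ≡ᵇ-suc r | m≤n⇒m⊓n≡m (n≤1+n r) = refl

edgeBetween-up : ∀ r c → edgeBetween (suc r , c) (r , c) ≡ ver r c
edgeBetween-up r c rewrite suc-≡ᵇ r | m≥n⇒m⊓n≡n (n≤1+n r) = refl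

edgeBetween-ends : ∀ {p q} → Adjacent p q → ends (edgeBetween p q) ≡ (p , q) ⊎ ends (edgeBetween p q) ≡ (q , p)
edgeBetween-ends {r , c} (inj₁ (refl , inj₁ refl)) = inj₁ (cong ends (edgeBetween-right r c))
edgeBetween-ends {r , _} {_ , c} (inj₁ (refl , inj₂ refl)) = inj₂ (cong ends (edgeBetween-left r c))
edgeBetween-ends {r , c} (inj₂ (refl , inj₁ refl)) = inj₁ (cong ends (edgeBetween-down r c))
edgeBetween-ends {_ , c} {r , _} (inj₂ (refl , inj₂ refl)) = inj₂ (cong ends (edgeBetween-up r c))

edgeBetween-incident₁ : ∀ {p q} → Adjacent p q → Incident p (edgeBetween p q)
edgeBetween-incident₁ adj with edgeBetween-ends adj
... | inj₁ eq = inj₁ (sym (cong proj₁ eq))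
... | inj₂ eq = inj₂ (sym (cong proj₂ eq))

edgeBetween-incident₂ : ∀ {p q} → Adjacent p q → Incident q (edgeBetween p q)
edgeBetween-incident₂ adj with edgeBetween-ends adj
... | inj₁ eq = inj₂ (sym (cong proj₂ eq))
... | inj₂ eq = inj₁ (sym (cong proj₁ eq))

incident-edgeBetween : ∀ {v p q} → Adjacent p q → Incident v (edgeBetween p q) → v ≡ p ⊎ v ≡ q
incident-edgeBetween {v} {p} {q} adj inc with edgeBetween-ends adj
... | inj₁ eq rewrite eq = inc
... | inj₂ eq rewrite eq = Data.Sum.swap inc

stepEdge : Vertex × Vertex → Edge
stepEdge p = edgeBetween (proj₁ p) (proj₂ p)

-- The four edges at the vertex (suc i , suc j), in the order used by SixVertex.
star : ℕ → ℕ → List Edge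
star i j = hor (suc i) j ∷ hor (suc i) (suc j) ∷ ver i (suc j) ∷ ver (suc i) (suc j) ∷ []

star-incident : ∀ {i j e} → e ∈ star i j → Incident (suc i , suc j) e
star-incident (here refl) = inj₂ refl
star-incident (there (here refl)) = inj₁ refl
star-incident (there (there (here refl))) = inj₂ refl
star-incident (there (there (there (here refl)))) = inj₁ refl

incident-star : ∀ {i j} e → Incident (suc i , suc j) e → e ∈ star i j
incident-star (hor r c) (inj₁ refl) = there (here refl)
incident-star (hor r c) (inj₂ refl) = here refl
incident-star (ver r c) (inj₁ refl) = there (there (there (here refl)))
incident-star (ver r c) (inj₂ refl) = there (there (here refl))

star-unique : ∀ i j → Unique (star i j)
star-unique i j =
  ((λ eq → 1+n≢n (sym (proj₂ (hor-inj eq)))) ∷ (λ ()) ∷ (λ ()) ∷ []) ∷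
  ((λ ()) ∷ (λ ()) ∷ []) ∷
  ((λ eq → 1+n≢n (sym (proj₁ (ver-inj eq)))) ∷ []) ∷ [] ∷ []

Steps : List Vertex → Set
Steps vs = All (λ p → Adjacent (proj₁ p) (proj₂ p)) (cyclicPairs vs)

InternalEdge : ℕ → Edge → Set
InternalEdge n e = Internal n (proj₁ (ends e)) × Internal n (proj₂ (ends e))

loopEdge-internal : ∀ {n vs e} → All (Internal n) vs → Steps vs → e ∈ loopEdges vs → InternalEdge n e
loopEdge-internal internal steps e∈ with ∈-map⁻ stepEdge e∈
... | (p , q) , pq∈ , refl with cyclicPairs-∈ pq∈ | edgeBetween-ends (All.lookup steps pq∈)
... | p∈ , q∈ | inj₁ eq rewrite eq = All.lookup internal p∈ , All.lookup internal q∈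
... | p∈ , q∈ | inj₂ eq rewrite eq = All.lookup internal q∈ , All.lookup internal p∈

loopEdge-endpoint : ∀ {vs v e} → Steps vs → e ∈ loopEdges vs → Incident v e → v ∈ vs
loopEdge-endpoint steps e∈ inc with ∈-map⁻ stepEdge e∈
... | (p , q) , pq∈ , refl with incident-edgeBetween (All.lookup steps pq∈) inc
... | inj₁ refl = proj₁ (cyclicPairs-∈ pq∈)
... | inj₂ refl = proj₂ (cyclicPairs-∈ pq∈)

record Sides (P : Edge → Set) (n : ℕ) : Set where
  field
    top    : ∀ k → k < n → P (ver 0 (suc k))
    right  : ∀ k → k < n → P (hor (suc k) n)
    bottom : ∀ k → k < n → P (ver n (suc k))
    left   : ∀ k → k < n → P (hor (suc k) 0)

sides⁺ : ∀ {P n} → Sides P n → All P (boundaryEdges n)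
sides⁺ {n = n} S =
  All.++⁺ (side top) (All.++⁺ (side right) (All.++⁺ (reversed (side bottom)) (reversed (side left))))
  where
  open Sides S
  side : ∀ {P : Edge → Set} {f : ℕ → Edge} → (∀ k → k < n → P (f k)) → All P (map f (upTo n))
  side holds = All.map⁺ (All.tabulate (λ k∈ → holds _ (∈-upTo⁻ k∈)))
  reversed : ∀ {P : Edge → Set} {xs} → All P xs → All P (reverse xs)
  reversed {xs = xs} = All-resp-↭ (↭-sym (↭-reverse xs))

sides⁻ : ∀ {P n} → All P (boundaryEdges n) → Sides P n
sides⁻ {n = n} all = record
  { top = side all₁ ; right = side all₂ ; bottom = side (unreversed all₃) ; left = side (unreversed all₄) }
  where
  T = map (λ k → ver 0 (suc k)) (upTo n)
  R = map (λ k → hor (suc k) n) (upTo n)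
  B = reverse (map (λ k → ver n (suc k)) (upTo n))
  all₁ = All.++⁻ˡ T all
  all₂ = All.++⁻ˡ R (All.++⁻ʳ T all)
  all₃ = All.++⁻ˡ B (All.++⁻ʳ R (All.++⁻ʳ T all))
  all₄ = All.++⁻ʳ B (All.++⁻ʳ R (All.++⁻ʳ T all))
  side : ∀ {P : Edge → Set} {f : ℕ → Edge} → All P (map f (upTo n)) → ∀ k → k < n → P (f k)
  side holds k k<n = All.lookup (All.map⁻ holds) (∈-upTo⁺ k<n)
  unreversed : ∀ {P : Edge → Set} {xs} → All P (reverse xs) → All P xs
  unreversed {xs = xs} = All-resp-↭ (↭-reverse xs)

boundary-not-internal : ∀ n → All (λ e → ¬ InternalEdge n e) (boundaryEdges n)
boundary-not-internal n = sides⁺ (record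
  { top = λ k _ → λ { (((() , _) , _) , _) }
  ; right = λ k _ internal → <-irrefl refl (proj₂ (proj₂ (proj₂ internal)))
  ; bottom = λ k _ internal → <-irrefl refl (proj₂ (proj₁ (proj₂ internal)))
  ; left = λ k _ → λ { ((_ , (() , _)) , _) }
  })

-- Dark counts.  Exchanging the colours of two edges at a vertex keeps the
-- number of dark edges there.

countDark-cong : ∀ {φ ψ : Colouring} Es → (∀ {e} → e ∈ Es → ψ e ≡ φ e) →
                 countDark (map ψ Es) ≡ countDark (map φ Es)
countDark-cong [] agree = refl
countDark-cong (e ∷ Es) agree =
  cong₂ (λ b k → bit b + k) (agree (here refl)) (countDark-cong Es (λ e∈ → agree (there e∈)))

countDark-recolour : ∀ {φ ψ : Colouring} {e} Es → Unique Es → e ∈ Es →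
  (∀ {x} → x ∈ Es → x ≢ e → ψ x ≡ φ x) →
  countDark (map ψ Es) + bit (φ e) ≡ countDark (map φ Es) + bit (ψ e)
countDark-recolour {φ} {ψ} {e} (.e ∷ Es) (e∉Es ∷ _) (here refl) agree = begin
  bit (ψ e) + countDark (map ψ Es) + bit (φ e) ≡⟨ cong (λ k → bit (ψ e) + k + bit (φ e)) rest ⟩
  bit (ψ e) + countDark (map φ Es) + bit (φ e) ≡⟨ +-comm (bit (ψ e) + _) _ ⟩
  bit (φ e) + (bit (ψ e) + countDark (map φ Es)) ≡⟨ cong (bit (φ e) +_) (+-comm (bit (ψ e)) _) ⟩
  bit (φ e) + (countDark (map φ Es) + bit (ψ e)) ≡⟨ sym (+-assoc (bit (φ e)) _ _) ⟩
  bit (φ e) + countDark (map φ Es) + bit (ψ e) ∎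
  where
  open ≡-Reasoning
  rest : countDark (map ψ Es) ≡ countDark (map φ Es)
  rest = countDark-cong Es (λ x∈ → agree (there x∈) (λ x≡e → All.lookup e∉Es x∈ (sym x≡e)))
countDark-recolour {φ} {ψ} {e} (x ∷ Es) (x∉Es ∷ uniq) (there e∈) agree = begin
  bit (ψ x) + countDark (map ψ Es) + bit (φ e) ≡⟨ +-assoc (bit (ψ x)) _ _ ⟩
  bit (ψ x) + (countDark (map ψ Es) + bit (φ e)) ≡⟨ cong₂ _+_ (cong bit (agree (here refl) x≢e)) (countDark-recolour Es uniq e∈ (λ y∈ → agree (there y∈))) ⟩
  bit (φ x) + (countDark (map φ Es) + bit (ψ e)) ≡⟨ sym (+-assoc (bit (φ x)) _ _) ⟩
  bit (φ x) + countDark (map φ Es) + bit (ψ e) ∎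
  where
  open ≡-Reasoning
  x≢e : x ≢ e
  x≢e = All.lookup x∉Es e∈

countDark-exchange : ∀ {φ ψ : Colouring} {e₁ e₂} Es → Unique Es → e₁ ∈ Es → e₂ ∈ Es → e₁ ≢ e₂ →
  (∀ {x} → x ∈ Es → x ≢ e₁ → x ≢ e₂ → ψ x ≡ φ x) → ψ e₁ ≡ φ e₂ → ψ e₂ ≡ φ e₁ →
  countDark (map ψ Es) ≡ countDark (map φ Es)
countDark-exchange {φ} {ψ} {e₁} {e₂} Es uniq e₁∈ e₂∈ e₁≢e₂ agree ψe₁ ψe₂ =
  +-cancelʳ-≡ (bit (φ e₂)) _ _ (begin
    countDark (map ψ Es) + bit (φ e₂)  ≡⟨ cong (λ b → countDark (map ψ Es) + bit b) (sym χe₂) ⟩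
    countDark (map ψ Es) + bit (χ e₂)  ≡⟨ countDark-recolour Es uniq e₂∈ agree₂ ⟩
    countDark (map χ Es) + bit (ψ e₂)  ≡⟨ cong (λ b → countDark (map χ Es) + bit b) ψe₂ ⟩
    countDark (map χ Es) + bit (φ e₁)  ≡⟨ countDark-recolour Es uniq e₁∈ agree₁ ⟩
    countDark (map φ Es) + bit (χ e₁)  ≡⟨ cong (λ b → countDark (map φ Es) + bit b) (trans χe₁ ψe₁) ⟩
    countDark (map φ Es) + bit (φ e₂)  ∎)
  where
  open ≡-Reasoning
  χ : Colouring
  χ e with e ≟E e₁
  ... | yes _ = ψ e₁
  ... | no _ = φ e
  χe₁ : χ e₁ ≡ ψ e₁
  χe₁ with e₁ ≟E e₁
  ... | yes _ = refl
  ... | no ne = ⊥-elim (ne refl)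
  χe₂ : χ e₂ ≡ φ e₂
  χe₂ with e₂ ≟E e₁
  ... | yes e₂≡e₁ = ⊥-elim (e₁≢e₂ (sym e₂≡e₁))
  ... | no _ = refl
  agree₁ : ∀ {x} → x ∈ Es → x ≢ e₁ → χ x ≡ φ x
  agree₁ {x} _ x≢e₁ with x ≟E e₁
  ... | yes x≡e₁ = ⊥-elim (x≢e₁ x≡e₁)
  ... | no _ = refl
  agree₂ : ∀ {x} → x ∈ Es → x ≢ e₂ → ψ x ≡ χ x
  agree₂ {x} x∈ x≢e₂ with x ≟E e₁
  ... | yes refl = refl
  ... | no x≢e₁ = agree x∈ x≢e₁ x≢e₂

-- Alternating loops, locally.  At each of its vertices an alternating loop
-- uses two edges of different colours, so toggling the loop exchanges their
-- colours and keeps the six-vertex condition.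

record AlternatingCycle (φ : Colouring) (vs : List Vertex) : Set where
  field
    noRepeats   : Unique vs
    atLeast3    : 3 ≤ length vs
    steps       : Steps vs
    alternating : AlternatingAlong φ vs

alternatingCycle : ∀ {n φ} (γ : SimpleLoop n) → AlternatingLoop φ γ → AlternatingCycle φ (verts γ)
alternatingCycle γ alt = record
  { noRepeats = distinct γ ; atLeast3 = long γ ; steps = adjacent γ ; alternating = alt }

rotation-alternatingCycle : ∀ {φ vs vs'} → Rotation vs vs' → AlternatingCycle φ vs → AlternatingCycle φ vs'
rotation-alternatingCycle {φ} rot C = record
  { noRepeats = Unique-resp-↭ (setoid Vertex) (↭⇒↭ₛ (rotation-↭ rot)) noRepeats
  ; atLeast3 = subst (3 ≤_) (↭-length (rotation-↭ rot)) atLeast3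
  ; steps = All-resp-↭ (rotation-↭ (rotation-cyclicPairs rot)) steps
  ; alternating = All-resp-↭ (rotation-↭ (rotation-cyclicPairs (rotation-map φ (rotation-map stepEdge (rotation-cyclicPairs rot))))) alternating
  }
  where open AlternatingCycle C

record LoopThrough (φ : Colouring) (L : List Edge) (v : Vertex) : Set where
  field
    inEdge outEdge     : Edge
    inEdge∈            : inEdge ∈ L
    outEdge∈           : outEdge ∈ L
    inEdge-incident    : Incident v inEdge
    outEdge-incident   : Incident v outEdge
    in≢out             : inEdge ≢ outEdge
    colours-differ     : φ inEdge ≢ φ outEdge
    only               : ∀ {e} → e ∈ L → Incident v e → e ≡ inEdge ⊎ e ≡ outEdge

loopThrough-resp : ∀ {φ L L' v} → (∀ {e} → e ∈ L → e ∈ L') → (∀ {e} → e ∈ L' → e ∈ L) →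
                   LoopThrough φ L v → LoopThrough φ L' v
loopThrough-resp L⊆L' L'⊆L P = record
  { inEdge = inEdge ; outEdge = outEdge
  ; inEdge∈ = L⊆L' inEdge∈ ; outEdge∈ = L⊆L' outEdge∈
  ; inEdge-incident = inEdge-incident ; outEdge-incident = outEdge-incident
  ; in≢out = in≢out ; colours-differ = colours-differ
  ; only = λ e∈ → only (L'⊆L e∈)
  }
  where open LoopThrough P

-- The local picture at the first vertex v of an alternating cycle v ∷ b ∷ R:
-- the loop leaves v towards b and enters v from the last vertex of b ∷ R.
loopThrough-first : ∀ {φ v T} → AlternatingCycle φ (v ∷ T) → LoopThrough φ (loopEdges (v ∷ T)) v
loopThrough-first {T = []} C with AlternatingCycle.atLeast3 C
... | s≤s ()
loopThrough-first {T = _ ∷ []} C with AlternatingCycle.atLeast3 C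
... | s≤s (s≤s ())
loopThrough-first {φ} {v} {b ∷ b₂ ∷ R'} C = record
  { inEdge = edgeBetween u v ; outEdge = edgeBetween v b
  ; inEdge∈ = there (∈-map⁺ stepEdge last∈Z)
  ; outEdge∈ = here refl
  ; inEdge-incident = edgeBetween-incident₂ (adjZ last∈Z)
  ; outEdge-incident = edgeBetween-incident₁ adj₁
  ; in≢out = in≢out
  ; colours-differ = λ eq → alternating-ends (φ (edgeBetween v b)) (map φ (map stepEdge Z)) alternating (trans lastColour eq)
  ; only = only
  }
  where
  open AlternatingCycle C
  R = b₂ ∷ R'
  u = lastOf b R
  Z = zip (b ∷ R) (R ++ v ∷ [])
  Z≡ : Z ≡ consecutive (b ∷ R ++ v ∷ [])
  Z≡ = zip-consecutive b R v
  last∈Z : (u , v) ∈ Z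
  last∈Z = subst ((u , v) ∈_) (sym Z≡) (lastStep-∈ b R v)
  adj₁ : Adjacent v b
  adj₁ = All.head steps
  adjZ : ∀ {p q} → (p , q) ∈ Z → Adjacent p q
  adjZ = All.lookup (All.tail steps)
  v∉ : v ∉ b ∷ R
  v∉ v∈ = All.lookup (AllPairs.head noRepeats) v∈ refl
  b∉R : b ∉ R
  b∉R b∈ = All.lookup (AllPairs.head (AllPairs.tail noRepeats)) b∈ refl
  lastColour : lastOf (φ (edgeBetween v b)) (map φ (map stepEdge Z)) ≡ φ (edgeBetween u v)
  lastColour = begin
    lastOf (φ (edgeBetween v b)) (map φ (map stepEdge Z)) ≡⟨ lastOf-map φ (edgeBetween v b) (map stepEdge Z) ⟩
    φ (lastOf (edgeBetween v b) (map stepEdge Z))         ≡⟨ cong φ (lastOf-map stepEdge (v , b) Z) ⟩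
    φ (stepEdge (lastOf (v , b) Z))                       ≡⟨ cong (λ l → φ (stepEdge (lastOf (v , b) l))) Z≡ ⟩
    φ (stepEdge (lastOf (v , b) (consecutive (b ∷ R ++ v ∷ [])))) ≡⟨ cong (φ ∘ stepEdge) (lastOf-consecutive (v , b) b R v) ⟩
    φ (edgeBetween u v) ∎
    where open ≡-Reasoning
  in≢out : edgeBetween u v ≢ edgeBetween v b
  in≢out eq with incident-edgeBetween (adjZ last∈Z) (subst (Incident b) (sym eq) (edgeBetween-incident₂ adj₁))
  ... | inj₁ b≡u = b∉R (subst (_∈ R) (sym b≡u) (lastOf-∈ b₂ R'))
  ... | inj₂ b≡v = v∉ (here (sym b≡v))
  only : ∀ {e} → e ∈ loopEdges (v ∷ b ∷ R) → Incident v e → e ≡ edgeBetween u v ⊎ e ≡ edgeBetween v b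
  only (here refl) _ = inj₂ refl
  only (there e∈) inc with ∈-map⁻ stepEdge e∈
  ... | (p , q) , pq∈ , refl with incident-edgeBetween (adjZ pq∈) inc
  ...   | inj₁ refl = ⊥-elim (v∉ (step-source-∈ b R v (subst ((v , q) ∈_) Z≡ pq∈)))
  ...   | inj₂ refl = inj₁ (cong (λ x → edgeBetween x v) (step-into-end b R v (subst ((p , v) ∈_) Z≡ pq∈) (λ v∈ → v∉ (there v∈))))

loopThrough : ∀ {φ vs v} → AlternatingCycle φ vs → v ∈ vs → LoopThrough φ (loopEdges vs) v
loopThrough {φ} {vs} {v} C v∈ with rotation-to-front v∈
... | T , rot = loopThrough-resp (∈-resp-↭ (↭-sym edges↭)) (∈-resp-↭ edges↭)
                  (loopThrough-first (rotation-alternatingCycle rot C))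
  where
  edges↭ : loopEdges vs ↭ loopEdges (v ∷ T)
  edges↭ = rotation-↭ (rotation-map stepEdge (rotation-cyclicPairs rot))

-- Toggling the edges of a loop through a vertex exchanges the colours of
-- its two loop edges there, so the six-vertex condition is kept ...
toggle-at-loop-vertex : ∀ {φ L i j} → LoopThrough φ L (suc i , suc j) →
  countDark (map φ (star i j)) ≡ 2 → countDark (map (toggle φ L) (star i j)) ≡ 2
toggle-at-loop-vertex {φ} {L} {i} {j} P two = trans exchanged two
  where
  open LoopThrough P
  untouched : ∀ {x} → x ∈ star i j → x ≢ inEdge → x ≢ outEdge → toggle φ L x ≡ φ x
  untouched {x} x∈ x≢in x≢out = toggle-∉ φ λ x∈L → [ x≢in , x≢out ]′ (only {x} x∈L (star-incident {e = x} x∈))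
  exchanged : countDark (map (toggle φ L) (star i j)) ≡ countDark (map φ (star i j))
  exchanged = countDark-exchange (star i j) (star-unique i j)
    (incident-star _ inEdge-incident) (incident-star _ outEdge-incident) in≢out untouched
    (trans (toggle-∈ φ inEdge∈) (sym (¬-not (colours-differ ∘ sym))))
    (trans (toggle-∈ φ outEdge∈) (sym (¬-not colours-differ)))

toggle-off-loop-vertex : ∀ {φ L i j} → (∀ {e} → e ∈ L → ¬ Incident (suc i , suc j) e) →
  countDark (map (toggle φ L) (star i j)) ≡ countDark (map φ (star i j))
toggle-off-loop-vertex {φ} {i = i} {j} apart =
  countDark-cong (star i j) (λ {e} e∈ → toggle-∉ φ (λ e∈L → apart {e} e∈L (star-incident {e = e} e∈)))

flip-off-internal : ∀ {n} φ (γ : SimpleLoop n) {e} → ¬ InternalEdge n e → flipLoop φ γ e ≡ φ e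
flip-off-internal φ γ e-ext =
  flip-off-loop φ (verts γ) (λ e∈ → e-ext (loopEdge-internal (internal γ) (adjacent γ) e∈))

fpl-resp : ∀ {n φ ψ} → φ ≗ ψ → FPL n φ → FPL n ψ
fpl-resp {n} {φ} {ψ} φ≗ψ (six , wall) = six' , trans (sym (map-cong φ≗ψ (boundaryEdges n))) wall
  where
  six' : SixVertex n ψ
  six' i j i<n j<n = trans (countDark-cong (star i j) (λ {e} _ → sym (φ≗ψ e))) (six i j i<n j<n)

-- Flipping an alternating loop of an FPL gives an FPL: the six-vertex
-- condition survives by the local analysis above, and the boundary is
-- untouched because loops only use internal edges.
flip-fpl : ∀ {n φ} → FPL n φ → (γ : SimpleLoop n) → AlternatingLoop φ γ → FPL n (flipLoop φ γ)
flip-fpl {n} {φ} (six , wall) γ alt = fpl-resp (λ e → sym (flip-alternating φ (verts γ) alt e)) (six' , wall')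
  where
  L = loopEdges (verts γ)
  six' : SixVertex n (toggle φ L)
  six' i j i<n j<n with (suc i , suc j) ∈? verts γ
  ... | yes v∈ = toggle-at-loop-vertex (loopThrough (alternatingCycle γ alt) v∈) (six i j i<n j<n)
  ... | no v∉ = trans (toggle-off-loop-vertex {φ} {L} (λ {e} e∈ inc → v∉ (loopEdge-endpoint {e = e} (adjacent γ) e∈ inc))) (six i j i<n j<n)
  wall' : DomainWall n (toggle φ L)
  wall' = trans (map-cong-local (All.map (λ e-ext → toggle-∉ φ (λ e∈ → e-ext (loopEdge-internal (internal γ) (adjacent γ) e∈)))
                                          (boundary-not-internal n))) wall

-- The spins of the edges integrate to a height function on the
-- faces; the six-vertex condition makes it path independent, the domain
-- wall boundary fixes it on the boundary, and it determines the FPL.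

isEven : ℕ → Bool
isEven zero = true
isEven (suc k) = not (isEven k)

agrees : Bool → Bool → Bool
agrees x p = if x then p else not p

-- Spins of the edges: 1 iff the colour agrees with the reference colouring
-- in which ver a c is dark iff a + c is odd and hor r b is dark iff r + b is even.
spinV : Colouring → ℕ → ℕ → ℕ
spinV φ a c = bit (agrees (φ (ver a c)) (isEven (suc (a + c))))

spinH : Colouring → ℕ → ℕ → ℕ
spinH φ r b = bit (agrees (φ (hor r b)) (isEven (r + b)))

-- Heights live on the faces (a , b), 0 ≤ a,b ≤ n: face (a , b) is the unit
-- square between rows a, a+1 and columns b, b+1; ver a b separates faces
-- (a , b-1) and (a , b), and hor a b separates (a-1 , b) and (a , b).
-- The height of a face adds up the spins of the edges crossed on the way
-- from the top-left face (0 , 0), first down column 0 and then along row a.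
leftHeight : Colouring → ℕ → ℕ
leftHeight φ zero = 0
leftHeight φ (suc a) = leftHeight φ a + spinH φ (suc a) 0

height : Colouring → ℕ → ℕ → ℕ
height φ a zero = leftHeight φ a
height φ a (suc b) = height φ a b + spinV φ a (suc b)

-- The six-vertex condition, in terms of spins: around a vertex with two
-- dark edges the spins of the upper and right edges add up to those of the
-- left and lower edges.  (A finite check over the colours of the four
-- edges l, r, u, d and the reference colour P of the upper and right edges.)
vertex-rule-table : ∀ P l r u d → bit l + (bit r + (bit u + (bit d + 0))) ≡ 2 →
  bit (agrees u P) + bit (agrees r P) ≡ bit (agrees l (not P)) + bit (agrees d (not P))
vertex-rule-table false false false false false ()
vertex-rule-table false false false false true ()
vertex-rule-table false false false true false ()
vertex-rule-table false false false true true _ = refl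
vertex-rule-table false false true false false ()
vertex-rule-table false false true false true _ = refl
vertex-rule-table false false true true false _ = refl
vertex-rule-table false false true true true ()
vertex-rule-table false true false false false ()
vertex-rule-table false true false false true _ = refl
vertex-rule-table false true false true false _ = refl
vertex-rule-table false true false true true ()
vertex-rule-table false true true false false _ = refl
vertex-rule-table false true true false true ()
vertex-rule-table false true true true false ()
vertex-rule-table false true true true true ()
vertex-rule-table true false false false false ()
vertex-rule-table true false false false true ()
vertex-rule-table true false false true false ()
vertex-rule-table true false false true true _ = refl
vertex-rule-table true false true false false ()
vertex-rule-table true false true false true _ = refl
vertex-rule-table true false true true false _ = refl
vertex-rule-table true false true true true ()
vertex-rule-table true true false false false ()
vertex-rule-table true true false false true _ = refl
vertex-rule-table true true false true false _ = refl
vertex-rule-table true true false true true ()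
vertex-rule-table true true true false false _ = refl
vertex-rule-table true true true false true ()
vertex-rule-table true true true true false ()
vertex-rule-table true true true true true ()

-- the same for the star of the vertex (suc i , suc j), whose upper and right
-- edges have equal reference colour, opposite to that of its left and lower edges
vertex-rule : ∀ φ i j → countDark (map φ (star i j)) ≡ 2 →
  spinV φ i (suc j) + spinH φ (suc i) (suc j) ≡ spinH φ (suc i) j + spinV φ (suc i) (suc j)
vertex-rule φ i j two =
  subst (λ p → spinV φ i (suc j) + spinH φ (suc i) (suc j) ≡ bit (agrees (φ (hor (suc i) j)) p) + spinV φ (suc i) (suc j))
        (trans (not-involutive (isEven (i + suc j))) (cong isEven (+-suc i j)))
        (vertex-rule-table (isEven (suc (i + suc j))) (φ (hor (suc i) j)) (φ (hor (suc i) (suc j)))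
                           (φ (ver i (suc j))) (φ (ver (suc i) (suc j))) two)

-- Hence the height is path independent: stepping down from face (a , b)
-- to (a+1 , b) adds the spin of the horizontal edge crossed.
height-down : ∀ {n φ} → SixVertex n φ → ∀ a b → a < n → b ≤ n →
              height φ (suc a) b ≡ height φ a b + spinH φ (suc a) b
height-down six a zero a<n _ = refl
height-down {φ = φ} six a (suc b) a<n b<n = begin
  height φ (suc a) b + spinV φ (suc a) (suc b)               ≡⟨ cong (_+ spinV φ (suc a) (suc b)) (height-down six a b a<n (<⇒≤ b<n)) ⟩
  height φ a b + spinH φ (suc a) b + spinV φ (suc a) (suc b) ≡⟨ +-assoc (height φ a b) _ _ ⟩
  height φ a b + (spinH φ (suc a) b + spinV φ (suc a) (suc b)) ≡⟨ cong (height φ a b +_) (vertex-rule φ a b (six a b a<n b<n)) ⟨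
  height φ a b + (spinV φ a (suc b) + spinH φ (suc a) (suc b)) ≡⟨ +-assoc (height φ a b) _ _ ⟨
  height φ a (suc b) + spinH φ (suc a) (suc b) ∎
  where open ≡-Reasoning

map-≡⇒pointwise : ∀ {A B : Set} {f g : A → B} xs → map f xs ≡ map g xs → All (λ x → f x ≡ g x) xs
map-≡⇒pointwise [] _ = []
map-≡⇒pointwise (x ∷ xs) eq = proj₁ (∷-injective eq) ∷ map-≡⇒pointwise xs (proj₂ (∷-injective eq))

domainWall-agree : ∀ {n χ ω} → DomainWall n χ → DomainWall n ω → Sides (λ e → χ e ≡ ω e) n
domainWall-agree {n} wall-χ wall-ω = sides⁻ (map-≡⇒pointwise (boundaryEdges n) (trans wall-χ (sym wall-ω)))

-- Consequently two FPLs of the same size have equal heights on the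
-- boundary faces: along column 0, row 0 and row n the height only involves
-- external edges, and column n is reached from row 0 by height-down across
-- the external edges on the right.
module BoundaryHeights {n χ ω} (χ-fpl : FPL n χ) (ω-fpl : FPL n ω) where
  open Sides (domainWall-agree {n} (proj₂ χ-fpl) (proj₂ ω-fpl))

  leftHeight-agree : ∀ a → a ≤ n → leftHeight χ a ≡ leftHeight ω a
  leftHeight-agree zero _ = refl
  leftHeight-agree (suc a) a<n =
    cong₂ _+_ (leftHeight-agree a (<⇒≤ a<n)) (cong (λ x → bit (agrees x (isEven (suc a + 0)))) (left a a<n))

  row-agree : ∀ a b → a ≤ n → b ≤ n → (∀ k → k < n → χ (ver a (suc k)) ≡ ω (ver a (suc k))) →
              height χ a b ≡ height ω a b
  row-agree a zero a≤n _ _ = leftHeight-agree a a≤n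
  row-agree a (suc b) a≤n b<n vertical =
    cong₂ _+_ (row-agree a b a≤n (<⇒≤ b<n) vertical) (cong (λ x → bit (agrees x (isEven (suc (a + suc b))))) (vertical b b<n))

  column-n-agree : ∀ a → a ≤ n → height χ a n ≡ height ω a n
  column-n-agree zero _ = row-agree 0 n z≤n ≤-refl top
  column-n-agree (suc a) a<n = begin
    height χ (suc a) n                ≡⟨ height-down (proj₁ χ-fpl) a n a<n ≤-refl ⟩
    height χ a n + spinH χ (suc a) n  ≡⟨ cong₂ _+_ (column-n-agree a (<⇒≤ a<n)) (cong (λ x → bit (agrees x (isEven (suc a + n)))) (right a a<n)) ⟩
    height ω a n + spinH ω (suc a) n  ≡⟨ height-down (proj₁ ω-fpl) a n a<n ≤-refl ⟨
    height ω (suc a) n                ∎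
    where open ≡-Reasoning

  boundary-heights : ∀ a b → a ≤ n → b ≤ n → a ≡ 0 ⊎ a ≡ n ⊎ b ≡ 0 ⊎ b ≡ n → height χ a b ≡ height ω a b
  boundary-heights a b a≤n b≤n (inj₁ refl) = row-agree 0 b z≤n b≤n top
  boundary-heights a b a≤n b≤n (inj₂ (inj₁ refl)) = row-agree n b ≤-refl b≤n bottom
  boundary-heights a b a≤n b≤n (inj₂ (inj₂ (inj₁ refl))) = leftHeight-agree a a≤n
  boundary-heights a b a≤n b≤n (inj₂ (inj₂ (inj₂ refl))) = column-n-agree a a≤n

agrees-injective : ∀ x y p → bit (agrees x p) ≡ bit (agrees y p) → x ≡ y
agrees-injective true true p _ = refl
agrees-injective false false p _ = refl
agrees-injective true false true ()
agrees-injective true false false ()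
agrees-injective false true true ()
agrees-injective false true false ()

-- FPLs with the same heights on all faces agree on every edge of the grid
-- graph, since each such edge separates two faces and its spin is their
-- height difference; the remaining edges are compared by hypothesis.
heights-determine : ∀ {n χ ω} → SixVertex n χ → SixVertex n ω →
  (∀ a b → a ≤ n → b ≤ n → height χ a b ≡ height ω a b) →
  (∀ e → ¬ InternalEdge n e → χ e ≡ ω e) → χ ≗ ω
heights-determine {n} {χ} {ω} six-χ six-ω same outside (ver a zero) =
  outside _ λ { ((_ , (() , _)) , _) }
heights-determine {n} {χ} {ω} six-χ six-ω same outside (ver a (suc b)) with a ≤? n | b <? n
... | no a≰n | _ = outside _ λ internal → a≰n (proj₂ (proj₁ (proj₁ internal)))
... | yes _ | no b≮n = outside _ λ internal → b≮n (proj₂ (proj₂ (proj₁ internal)))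
... | yes a≤n | yes b<n = agrees-injective _ _ (isEven (suc (a + suc b))) (+-cancelˡ-≡ (height χ a b) _ _ (begin
  height χ a (suc b)                ≡⟨ same a (suc b) a≤n b<n ⟩
  height ω a (suc b)                ≡⟨ cong (_+ spinV ω a (suc b)) (same a b a≤n (<⇒≤ b<n)) ⟨
  height χ a b + spinV ω a (suc b)  ∎))
  where open ≡-Reasoning
heights-determine {n} {χ} {ω} six-χ six-ω same outside (hor zero b) =
  outside _ λ { (((() , _) , _) , _) }
heights-determine {n} {χ} {ω} six-χ six-ω same outside (hor (suc a) b) with a <? n | b ≤? n
... | no a≮n | _ = outside _ λ internal → a≮n (proj₂ (proj₁ (proj₁ internal)))
... | yes _ | no b≰n = outside _ λ internal → b≰n (proj₂ (proj₂ (proj₁ internal)))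
... | yes a<n | yes b≤n = agrees-injective _ _ (isEven (suc a + b)) (+-cancelˡ-≡ (height χ a b) _ _ (begin
  height χ a b + spinH χ (suc a) b  ≡⟨ height-down six-χ a b a<n b≤n ⟨
  height χ (suc a) b                ≡⟨ same (suc a) b a<n b≤n ⟩
  height ω (suc a) b                ≡⟨ height-down six-ω a b a<n b≤n ⟩
  height ω a b + spinH ω (suc a) b  ≡⟨ cong (_+ spinH ω (suc a) b) (same a b (<⇒≤ a<n) b≤n) ⟨
  height χ a b + spinH ω (suc a) b  ∎))
  where open ≡-Reasoning

sum≤ : ℕ → (ℕ → ℕ) → ℕ
sum≤ zero f = f 0
sum≤ (suc m) f = sum≤ m f + f (suc m)

sum≤-cong : ∀ m {f g} → (∀ a → a ≤ m → f a ≡ g a) → sum≤ m f ≡ sum≤ m g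
sum≤-cong zero same = same 0 z≤n
sum≤-cong (suc m) same = cong₂ _+_ (sum≤-cong m (λ a a≤m → same a (m≤n⇒m≤1+n a≤m))) (same (suc m) ≤-refl)

sum≤-lower : ∀ m {f g} a₀ k → a₀ ≤ m → (∀ a → a ≢ a₀ → g a ≡ f a) → g a₀ + k ≡ f a₀ → sum≤ m g + k ≡ sum≤ m f
sum≤-lower zero .0 k z≤n same lowered = lowered
sum≤-lower (suc m) {f} {g} a₀ k a₀≤ same lowered with a₀ ≟ suc m
... | yes refl = begin
  sum≤ m g + g (suc m) + k    ≡⟨ +-assoc (sum≤ m g) _ k ⟩
  sum≤ m g + (g (suc m) + k)  ≡⟨ cong₂ _+_ (sum≤-cong m (λ a a≤m → same a (λ eq → <-irrefl eq (s≤s a≤m)))) lowered ⟩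
  sum≤ m f + f (suc m)        ∎
  where open ≡-Reasoning
... | no a₀≢ = begin
  sum≤ m g + g (suc m) + k    ≡⟨ +-assoc (sum≤ m g) _ k ⟩
  sum≤ m g + (g (suc m) + k)  ≡⟨ cong (sum≤ m g +_) (+-comm _ k) ⟩
  sum≤ m g + (k + g (suc m))  ≡⟨ +-assoc (sum≤ m g) k _ ⟨
  sum≤ m g + k + g (suc m)    ≡⟨ cong₂ _+_ (sum≤-lower m a₀ k (≤-pred (≤∧≢⇒< a₀≤ a₀≢)) same lowered) (same (suc m) (a₀≢ ∘ sym)) ⟩
  sum≤ m f + f (suc m)        ∎
  where open ≡-Reasoning

distance : ℕ → Colouring → Colouring → ℕ
distance n χ ω = sum≤ n (λ a → sum≤ n (λ b → ∣ height χ a b - height ω a b ∣))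

distance-sym : ∀ n χ ω → distance n χ ω ≡ distance n ω χ
distance-sym n χ ω = sum≤-cong n (λ a _ → sum≤-cong n (λ b _ → ∣-∣-comm (height χ a b) (height ω a b)))

distance-lower : ∀ n {χ χ' ω} r c → r ≤ n → c ≤ n →
  (∀ a b → (a ≡ r → b ≢ c) → height χ' a b ≡ height χ a b) →
  height χ' r c + 1 ≡ height χ r c → height ω r c < height χ r c →
  distance n χ' ω + 1 ≡ distance n χ ω
distance-lower n {χ} {χ'} {ω} r c r≤n c≤n elsewhere lowered above =
  sum≤-lower n r 1 r≤n
    (λ a a≢r → sum≤-cong n (λ b _ → cong (∣_- height ω a b ∣) (elsewhere a b (⊥-elim ∘ a≢r))))
    (sum≤-lower n c 1 c≤n (λ b b≢c → cong (∣_- height ω r b ∣) (elsewhere r b (λ _ → b≢c))) at-face)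
  where
  at-face : ∣ height χ' r c - height ω r c ∣ + 1 ≡ ∣ height χ r c - height ω r c ∣
  at-face = begin
    ∣ height χ' r c - height ω r c ∣ + 1  ≡⟨ cong (_+ 1) (m≤n⇒∣n-m∣≡n∸m ω≤χ') ⟩
    height χ' r c ∸ height ω r c + 1      ≡⟨ +-comm _ 1 ⟩
    1 + (height χ' r c ∸ height ω r c)    ≡⟨ +-∸-assoc 1 ω≤χ' ⟨
    1 + height χ' r c ∸ height ω r c      ≡⟨ cong (_∸ height ω r c) (trans (+-comm 1 _) lowered) ⟩
    height χ r c ∸ height ω r c           ≡⟨ m≤n⇒∣n-m∣≡n∸m (<⇒≤ above) ⟨
    ∣ height χ r c - height ω r c ∣       ∎
    where
    open ≡-Reasoning
    ω≤χ' : height ω r c ≤ height χ' r c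
    ω≤χ' = ≤-pred (subst (height ω r c <_) (trans (sym lowered) (+-comm _ 1)) above)

boxEdges : ℕ → ℕ → List Edge
boxEdges r c = hor r c ∷ ver r (suc c) ∷ hor (suc r) c ∷ ver r c ∷ []

boxEdges-loop : ∀ {n} (bx : Box n) → loopEdges (boxVerts bx) ≡ boxEdges (Box.row bx) (Box.col bx)
boxEdges-loop (box r c _ _ _ _) =
  cong₂ _∷_ (edgeBetween-right r c) (cong₂ _∷_ (edgeBetween-down r (suc c))
    (cong₂ _∷_ (edgeBetween-left (suc r) c) (cong₂ _∷_ (edgeBetween-up r c) refl)))

boxLoop : ∀ {n} → Box n → SimpleLoop n
boxLoop {n} bx@(box r c 1≤r r<n 1≤c c<n) = record
  { verts = boxVerts bx
  ; long = s≤s (s≤s (s≤s z≤n))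
  ; distinct = (col≢ ∷ row≢ ∷ row≢ ∷ []) ∷ (row≢ ∷ row≢ ∷ []) ∷ (col≢ ∘ sym ∷ []) ∷ [] ∷ []
  ; internal = ((1≤r , <⇒≤ r<n) , (1≤c , <⇒≤ c<n)) ∷ ((1≤r , <⇒≤ r<n) , (s≤s z≤n , c<n))
             ∷ ((s≤s z≤n , r<n) , (s≤s z≤n , c<n)) ∷ ((s≤s z≤n , r<n) , (1≤c , <⇒≤ c<n)) ∷ []
  ; adjacent = inj₁ (refl , inj₁ refl) ∷ inj₂ (refl , inj₁ refl) ∷ inj₁ (refl , inj₂ refl) ∷ inj₂ (refl , inj₂ refl) ∷ []
  }
  where
  col≢ : ∀ {a b : ℕ} → (a , c) ≢ (b , suc c)
  col≢ eq = 1+n≢n (sym (cong proj₂ eq))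
  row≢ : ∀ {a b : ℕ} → (r , a) ≢ (suc r , b)
  row≢ eq = 1+n≢n (sym (cong proj₁ eq))

reachable-snoc : ∀ {n χ ψ ω} → PlaquetteReachable n χ ψ → (bx : Box n) → plaquetteFlip ψ bx ≗ ω →
                 PlaquetteReachable n χ ω
reachable-snoc {ψ = ψ} (done χ≗ψ) bx flipped = step bx (done (λ e → trans (flip-cong (boxVerts bx) χ≗ψ e) (flipped e)))
reachable-snoc (step b path) bx flipped = step b (reachable-snoc path bx flipped)

spin-one : ∀ x p → bit (agrees x p) ≡ 1 → x ≡ p
spin-one true true _ = refl
spin-one false false _ = refl

spin-zero : ∀ x p → bit (agrees x p) ≡ 0 → x ≡ not p
spin-zero true false _ = refl
spin-zero false true _ = refl

spin-one-not : ∀ x p → bit (agrees x p) ≡ 1 → bit (agrees (not x) p) ≡ 0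
spin-one-not true true _ = refl
spin-one-not false false _ = refl

spin-zero-not : ∀ x p → bit (agrees x p) ≡ 0 → bit (agrees (not x) p) ≡ 1
spin-zero-not true false _ = refl
spin-zero-not false true _ = refl

alternating-4 : ∀ Y → AlternatingSeq (Y ∷ not Y ∷ Y ∷ not Y ∷ [])
alternating-4 true = (λ ()) ∷ (λ ()) ∷ (λ ()) ∷ (λ ()) ∷ []
alternating-4 false = (λ ()) ∷ (λ ()) ∷ (λ ()) ∷ (λ ()) ∷ []

-- The box at face (r , c) is a local maximum of the height of χ: the
-- height drops when leaving the face across any of the box's edges.
record LocalMaximum (χ : Colouring) (r c : ℕ) : Set where
  field
    left   : spinV χ r c ≡ 1
    right  : spinV χ r (suc c) ≡ 0
    top    : spinH χ r c ≡ 1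
    bottom : spinH χ (suc r) c ≡ 0

box-alternating : ∀ {n} χ (bx : Box n) → LocalMaximum χ (Box.row bx) (Box.col bx) →
                  AlternatingAlong χ (boxVerts bx)
box-alternating χ bx@(box r c _ _ _ _) M =
  subst (λ L → AlternatingSeq (map χ L)) (sym (boxEdges-loop bx))
    (subst AlternatingSeq (sym colours) (alternating-4 (isEven (r + c))))
  where
  open LocalMaximum M
  right-colour : χ (ver r (suc c)) ≡ not (isEven (r + c))
  right-colour = trans (spin-zero _ _ right)
                 (trans (cong (λ k → not (isEven (suc k))) (+-suc r c)) (cong not (not-involutive _)))
  colours : map χ (boxEdges r c) ≡ isEven (r + c) ∷ not (isEven (r + c)) ∷ isEven (r + c) ∷ not (isEven (r + c)) ∷ []
  colours = cong₂ _∷_ (spin-one _ _ top) (cong₂ _∷_ right-colour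
              (cong₂ _∷_ (trans (spin-zero _ _ bottom) (not-involutive _)) (cong₂ _∷_ (spin-one _ _ left) refl)))

-- Flipping the box at face (r , c) of χ, whose left vertical edge has
-- spin 1 and right vertical edge spin 0, lowers the height at face (r , c)
-- by one and leaves all other heights unchanged: only the spins of these
-- two edges enter the heights, and both only along row r.
module BoxFlipHeights (χ χ' : Colouring) (r c₀ : ℕ) (flipped : χ' ≗ toggle χ (boxEdges r (suc c₀)))
                      (left : spinV χ r (suc c₀) ≡ 1) (right : spinV χ r (suc (suc c₀)) ≡ 0) where

  c = suc c₀

  unflipped : ∀ {e} → e ∉ boxEdges r c → χ' e ≡ χ e
  unflipped e∉ = trans (flipped _) (toggle-∉ χ e∉)

  leftHeight-kept : ∀ a → leftHeight χ' a ≡ leftHeight χ a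
  leftHeight-kept zero = refl
  leftHeight-kept (suc a) = cong₂ _+_ (leftHeight-kept a) (cong (λ x → bit (agrees x (isEven (suc a + 0)))) (unflipped not-in-box))
    where
    not-in-box : hor (suc a) 0 ∉ boxEdges r c
    not-in-box (here ())
    not-in-box (there (there (here ())))
    not-in-box (there (there (there (there ()))))

  spinV-kept : ∀ a b → (a ≡ r → b ≢ c) → (a ≡ r → b ≢ suc c) → spinV χ' a b ≡ spinV χ a b
  spinV-kept a b not-left not-right = cong (λ x → bit (agrees x (isEven (suc (a + b))))) (unflipped not-in-box)
    where
    not-in-box : ver a b ∉ boxEdges r c
    not-in-box (there (here refl)) = not-right refl refl
    not-in-box (there (there (there (here refl)))) = not-left refl refl

  height-before : ∀ a b → (a ≡ r → b < c) → height χ' a b ≡ height χ a b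
  height-before a zero _ = leftHeight-kept a
  height-before a (suc b) before = cong₂ _+_ (height-before a b (λ a≡r → ≤-trans (n≤1+n (suc b)) (before a≡r)))
    (spinV-kept a (suc b) (λ a≡r → <⇒≢ (before a≡r)) (λ a≡r → <⇒≢ (m<n⇒m<1+n (before a≡r))))

  height-lowered : height χ' r c + 1 ≡ height χ r c
  height-lowered = begin
    height χ' r c₀ + spinV χ' r c + 1  ≡⟨ cong (λ h → h + spinV χ' r c + 1) (height-before r c₀ (λ _ → ≤-refl)) ⟩
    height χ r c₀ + spinV χ' r c + 1   ≡⟨ cong (λ s → height χ r c₀ + s + 1) left-flipped ⟩
    height χ r c₀ + 0 + 1              ≡⟨ cong (_+ 1) (+-identityʳ _) ⟩
    height χ r c₀ + 1                  ≡⟨ cong (height χ r c₀ +_) left ⟨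
    height χ r c₀ + spinV χ r c        ∎
    where
    open ≡-Reasoning
    left-flipped : spinV χ' r c ≡ 0
    left-flipped = trans (cong (λ x → bit (agrees x (isEven (suc (r + c)))))
                                (trans (flipped (ver r c)) (toggle-∈ χ {boxEdges r c} (there (there (there (here refl)))))))
                         (spin-one-not (χ (ver r c)) _ left)

  height-after : ∀ b → c < b → height χ' r b ≡ height χ r b
  height-after (suc b) (s≤s c≤b) with b ≟ c
  ... | yes refl = begin
    height χ' r c + spinV χ' r (suc c)  ≡⟨ cong (height χ' r c +_) right-flipped ⟩
    height χ' r c + 1                   ≡⟨ height-lowered ⟩
    height χ r c                        ≡⟨ +-identityʳ _ ⟨
    height χ r c + 0                    ≡⟨ cong (height χ r c +_) right ⟨
    height χ r c + spinV χ r (suc c)    ∎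
    where
    open ≡-Reasoning
    right-flipped : spinV χ' r (suc c) ≡ 1
    right-flipped = trans (cong (λ x → bit (agrees x (isEven (suc (r + suc c)))))
                                 (trans (flipped (ver r (suc c))) (toggle-∈ χ {boxEdges r c} (there (here refl)))))
                          (spin-zero-not (χ (ver r (suc c))) _ right)
  ... | no b≢c = cong₂ _+_ (height-after b (≤∧≢⇒< c≤b (b≢c ∘ sym)))
    (spinV-kept r (suc b) (λ _ eq → <-irrefl (sym eq) (s≤s c≤b)) (λ _ eq → b≢c (suc-injective eq)))

  height-kept : ∀ a b → (a ≡ r → b ≢ c) → height χ' a b ≡ height χ a b
  height-kept a b not-face with a ≟ r
  ... | no a≢r = height-before a b (⊥-elim ∘ a≢r)
  ... | yes refl with <-cmp b c
  ...   | tri< b<c _ _ = height-before a b (λ _ → b<c)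
  ...   | tri≈ _ b≡c _ = ⊥-elim (not-face refl b≡c)
  ...   | tri> _ _ c<b = height-after b c<b

-- Descent.  Among the faces where χ lies above ω, one of maximal priority
-- carries such a local maximum, so plaquette flips decrease the distance
-- until the two FPLs coincide.

faces : ℕ → List (ℕ × ℕ)
faces n = cartesianProduct (upTo (suc n)) (upTo (suc n))

face-∈ : ∀ {n a b} → a ≤ n → b ≤ n → (a , b) ∈ faces n
face-∈ a≤n b≤n = ∈-cartesianProduct⁺ (∈-upTo⁺ (s≤s a≤n)) (∈-upTo⁺ (s≤s b≤n))

Above : Colouring → Colouring → ℕ × ℕ → Set
Above χ ω (a , b) = height ω a b < height χ a b

above? : ∀ χ ω f → Dec (Above χ ω f)
above? χ ω (a , b) = height ω a b <? height χ a b

cornerDistance : ℕ → ℕ × ℕ → ℕ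
cornerDistance n (a , b) = (n ∸ a) + (n ∸ b)

priority : ℕ → Colouring → ℕ × ℕ → ℕ
priority n χ f = height χ (proj₁ f) (proj₂ f) + height χ (proj₁ f) (proj₂ f) + cornerDistance n f

record TopFace (n : ℕ) (χ ω : Colouring) : Set where
  field
    r c     : ℕ
    r≤n     : r ≤ n
    c≤n     : c ≤ n
    above   : Above χ ω (r , c)
    maximal : ∀ a b → a ≤ n → b ≤ n → Above χ ω (a , b) → priority n χ (a , b) ≤ priority n χ (r , c)

topFace : ∀ {n χ ω} f → f ∈ faces n → Above χ ω f → TopFace n χ ω
topFace {n} {χ} {ω} f f∈ f-above = record
  { r = proj₁ best ; c = proj₂ best
  ; r≤n = ≤-pred (∈-upTo⁻ (proj₁ best∈)) ; c≤n = ≤-pred (∈-upTo⁻ (proj₂ best∈))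
  ; above = proj₂ best-ok
  ; maximal = λ a b a≤n b≤n ab-above →
      All.lookup (f[xs]≤f[argmax] {f = priority n χ} f candidates) (∈-filter⁺ (above? χ ω) (face-∈ a≤n b≤n) ab-above)
  }
  where
  open import Data.List.Extrema ≤-totalOrder using (argmax; argmax-all; f[xs]≤f[argmax])
  candidates = filter (above? χ ω) (faces n)
  best = argmax (priority n χ) f candidates
  best-ok : best ∈ faces n × Above χ ω best
  best-ok = argmax-all (priority n χ) (f∈ , f-above) (All.tabulate (∈-filter⁻ (above? χ ω)))
  best∈ = ∈-cartesianProduct⁻ (upTo (suc n)) (upTo (suc n)) (proj₁ best-ok)

-- The two ways a neighbour g of a top face f could beat it.  Here h and w
-- are the heights in χ and ω, d the corner distance, and `beaten` says
-- that g cannot lie above ω with higher priority than f.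
-- (i) g is one step closer to the bottom-right corner: then χ does not
--     climb from f to g, otherwise g would lie above ω with priority one more.
no-climb-away : ∀ {hf hg wf wg df dg} (s t : Bool) → hg ≡ hf + bit s → wg ≡ wf + bit t → wf < hf →
  df ≡ suc dg → (wg < hg → hg + hg + dg ≤ hf + hf + df) → s ≡ false
no-climb-away false t _ _ _ _ _ = refl
no-climb-away {hf} {wf = wf} {dg = dg} true t refl refl wf<hf refl beaten =
  ⊥-elim (<-irrefl refl (≤-trans (≤-reflexive (sym gain)) (beaten g-above)))
  where
  g-above : wf + bit t < hf + 1
  g-above = ≤-trans (s≤s (≤-trans (+-monoʳ-≤ wf (bit≤1 t)) (≤-trans (≤-reflexive (+-comm wf 1)) wf<hf)))
                    (≤-reflexive (+-comm 1 hf))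
    where
    bit≤1 : ∀ b → bit b ≤ 1
    bit≤1 true = ≤-refl
    bit≤1 false = z≤n
  gain : hf + 1 + (hf + 1) + dg ≡ suc (hf + hf + suc dg)
  gain = solve 2 (λ h d → h :+ con 1 :+ (h :+ con 1) :+ d := con 1 :+ (h :+ h :+ (con 1 :+ d))) refl hf dg
    where open +-*-Solver

-- (ii) g is one step further from the corner: then χ climbs from g to f,
--      otherwise g would lie above ω at the same height, with priority one more.
climb-toward : ∀ {hf hg wf wg df dg} (s t : Bool) → hf ≡ hg + bit s → wf ≡ wg + bit t → wf < hf →
  dg ≡ suc df → (wg < hg → hg + hg + dg ≤ hf + hf + df) → s ≡ true
climb-toward true t _ _ _ _ _ = refl
climb-toward {hg = hg} {wg = wg} {df = df} false t refl refl wf<hf refl beaten =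
  ⊥-elim (<-irrefl refl (≤-trans (≤-reflexive (sym gain)) (beaten g-above)))
  where
  g-above : wg < hg
  g-above = ≤-trans (s≤s (m≤m+n wg (bit t))) (subst (wg + bit t <_) (+-identityʳ hg) wf<hf)
  gain : hg + hg + suc df ≡ suc (hg + 0 + (hg + 0) + df)
  gain = solve 2 (λ h d → h :+ h :+ (con 1 :+ d) := con 1 :+ (h :+ con 0 :+ (h :+ con 0) :+ d)) refl hg df
    where open +-*-Solver

∸-step : ∀ n c → c < n → n ∸ c ≡ suc (n ∸ suc c)
∸-step (suc n) zero _ = refl
∸-step (suc n) (suc c) (s≤s c<n) = ∸-step n c c<n

corner-right : ∀ n r c → c < n → cornerDistance n (r , c) ≡ suc (cornerDistance n (r , suc c))
corner-right n r c c<n = trans (cong ((n ∸ r) +_) (∸-step n c c<n)) (+-suc (n ∸ r) (n ∸ suc c))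

corner-down : ∀ n r c → r < n → cornerDistance n (r , c) ≡ suc (cornerDistance n (suc r , c))
corner-down n r c r<n = cong (_+ (n ∸ c)) (∸-step n r r<n)

record CloserBox (n : ℕ) (χ ω : Colouring) : Set where
  field
    bx          : Box n
    alternating : AlternatingAlong χ (boxVerts bx)
    closer      : distance n (plaquetteFlip χ bx) ω + 1 ≡ distance n χ ω

-- A top face is interior, since boundary heights agree, and its box is a
-- local maximum: were the height of χ to rise across an edge of the box,
-- the face beyond would lie above ω with higher priority.
topFace-local-maximum : ∀ {n χ ω} → FPL n χ → FPL n ω → (T : TopFace n χ ω) →
  Σ (Box n) λ bx → Box.row bx ≡ TopFace.r T × Box.col bx ≡ TopFace.c T × LocalMaximum χ (Box.row bx) (Box.col bx)
topFace-local-maximum {n} {χ} {ω} χ-fpl ω-fpl T = interior r c r≤n c≤n above maximal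
  where
  open TopFace T using (r; c; r≤n; c≤n; above; maximal)
  open BoundaryHeights χ-fpl ω-fpl
  on-boundary : ∀ {a b} → a ≤ n → b ≤ n → a ≡ 0 ⊎ a ≡ n ⊎ b ≡ 0 ⊎ b ≡ n → ¬ Above χ ω (a , b)
  on-boundary a≤n b≤n side ab-above = <-irrefl (sym (boundary-heights _ _ a≤n b≤n side)) ab-above
  interior : ∀ a b → a ≤ n → b ≤ n → Above χ ω (a , b) →
    (∀ a' b' → a' ≤ n → b' ≤ n → Above χ ω (a' , b') → priority n χ (a' , b') ≤ priority n χ (a , b)) →
    Σ (Box n) λ bx → Box.row bx ≡ a × Box.col bx ≡ b × LocalMaximum χ (Box.row bx) (Box.col bx)
  interior zero b a≤n b≤n ab-above _ = ⊥-elim (on-boundary a≤n b≤n (inj₁ refl) ab-above)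
  interior (suc a₀) zero a≤n b≤n ab-above _ = ⊥-elim (on-boundary a≤n b≤n (inj₂ (inj₂ (inj₁ refl))) ab-above)
  interior a@(suc a₀) b@(suc b₀) a≤n b≤n ab-above ab-maximal with a ≟ n | b ≟ n
  ... | yes a≡n | _ = ⊥-elim (on-boundary a≤n b≤n (inj₂ (inj₁ a≡n)) ab-above)
  ... | no _ | yes b≡n = ⊥-elim (on-boundary a≤n b≤n (inj₂ (inj₂ (inj₂ b≡n))) ab-above)
  ... | no a≢n | no b≢n = box a b (s≤s z≤n) a<n (s≤s z≤n) b<n , refl , refl , record
    { left = cong bit (climb-toward _ _ refl refl ab-above (corner-right n a b₀ b≤n) (ab-maximal a b₀ a≤n (<⇒≤ b≤n)))
    ; right = cong bit (no-climb-away _ _ refl refl ab-above (corner-right n a b b<n) (ab-maximal a (suc b) a≤n b<n))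
    ; top = cong bit (climb-toward _ _ (height-down (proj₁ χ-fpl) a₀ b a≤n b≤n) (height-down (proj₁ ω-fpl) a₀ b a≤n b≤n)
              ab-above (corner-down n a₀ b a≤n) (ab-maximal a₀ b (<⇒≤ a≤n) b≤n))
    ; bottom = cong bit (no-climb-away _ _ (height-down (proj₁ χ-fpl) a b a<n b≤n) (height-down (proj₁ ω-fpl) a b a<n b≤n)
                 ab-above (corner-down n a b a<n) (ab-maximal (suc a) b a<n b≤n))
    }
    where
    a<n = ≤∧≢⇒< a≤n a≢n
    b<n = ≤∧≢⇒< b≤n b≢n

topFace-box : ∀ {n χ ω} → FPL n χ → FPL n ω → TopFace n χ ω → CloserBox n χ ω
topFace-box {n} {χ} {ω} χ-fpl ω-fpl T with topFace-local-maximum χ-fpl ω-fpl T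
... | bx@(box r (suc c₀) _ _ _ _) , refl , refl , M = record
  { bx = bx
  ; alternating = alternating
  ; closer = distance-lower n r (suc c₀) (TopFace.r≤n T) (TopFace.c≤n T) height-kept height-lowered (TopFace.above T)
  }
  where
  alternating = box-alternating χ bx M
  open BoxFlipHeights χ (plaquetteFlip χ bx) r c₀
         (λ e → trans (flip-alternating χ (boxVerts bx) alternating e) (cong (λ L → toggle χ L e) (boxEdges-loop bx)))
         (LocalMaximum.left M) (LocalMaximum.right M) using (height-kept; height-lowered)
... | box _ zero _ _ () _ , _

descent-step : ∀ {n χ ω} → FPL n χ → FPL n ω → Any (Above χ ω) (faces n) → CloserBox n χ ω
descent-step χ-fpl ω-fpl somewhere-above with find somewhere-above
... | f , f∈ , f-above = topFace-box χ-fpl ω-fpl (topFace f f∈ f-above)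

closer-distance : ∀ {n χ ω k} (C : CloserBox n χ ω) → distance n χ ω ≡ k →
  Σ ℕ λ k' → k ≡ suc k' × distance n (plaquetteFlip χ (CloserBox.bx C)) ω ≡ k'
closer-distance {k = zero} C dist = ⊥-elim (1+n≢0 (trans (+-comm 1 _) (trans (CloserBox.closer C) dist)))
closer-distance {k = suc k'} C dist = k' , refl , suc-injective (trans (+-comm 1 _) (trans (CloserBox.closer C) dist))

-- Two FPLs of size n that agree off the internal edges are connected by
-- plaquette flips, by induction on their distance k: while one lies above
-- the other somewhere, a flip of that one decreases the distance, and
-- otherwise all heights, hence all edges, agree.
connect : ∀ {n} k {χ ω} → FPL n χ → FPL n ω → (∀ e → ¬ InternalEdge n e → χ e ≡ ω e) →
          distance n χ ω ≡ k → PlaquetteReachable n χ ω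
connect {n} k {χ} {ω} χ-fpl ω-fpl outside dist
  with any? (above? χ ω) (faces n) | any? (above? ω χ) (faces n)
... | yes χ-above | _ with descent-step χ-fpl ω-fpl χ-above
...   | C with closer-distance C dist
...     | k' , refl , dist' =
  step bx (connect k' (flip-fpl χ-fpl (boxLoop bx) alternating) ω-fpl
             (λ e e-ext → trans (flip-off-internal χ (boxLoop bx) e-ext) (outside e e-ext)) dist')
  where open CloserBox C
connect {n} k {χ} {ω} χ-fpl ω-fpl outside dist | no _ | yes ω-above with descent-step ω-fpl χ-fpl ω-above
...   | C with closer-distance C (trans (distance-sym n ω χ) dist)
...     | k' , refl , dist' =
  reachable-snoc (connect k' χ-fpl (flip-fpl ω-fpl (boxLoop bx) alternating)
                    (λ e e-ext → trans (outside e e-ext) (sym (flip-off-internal ω (boxLoop bx) e-ext)))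
                    (trans (distance-sym n χ _) dist'))
                 bx (flip-involutive ω (boxVerts bx) alternating)
  where open CloserBox C
connect {n} k {χ} {ω} χ-fpl ω-fpl outside dist | no χ-nowhere-above | no ω-nowhere-above =
  done (heights-determine (proj₁ χ-fpl) (proj₁ ω-fpl) same outside)
  where
  same : ∀ a b → a ≤ n → b ≤ n → height χ a b ≡ height ω a b
  same a b a≤n b≤n = ≤-antisym (≮⇒≥ (λ ω<χ → χ-nowhere-above (lose (face-∈ a≤n b≤n) ω<χ)))
                               (≮⇒≥ (λ χ<ω → ω-nowhere-above (lose (face-∈ a≤n b≤n) χ<ω)))

mainTheorem7 : (n : ℕ) (φ : Colouring) → FPL n φ →
    (γ : SimpleLoop n) → AlternatingLoop φ γ →
    PlaquetteReachable n φ (flipLoop φ γ)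
mainTheorem7 n φ φ-fpl γ alt =
  connect (distance n φ (flipLoop φ γ)) φ-fpl (flip-fpl φ-fpl γ alt)
    (λ e e-ext → sym (flip-off-internal φ γ e-ext)) refl
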